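{- (1) $\mathcal{BA}\not\subseteq V(\mathbf{A}_5)$ and $V(\mathbf{A}_5)\not\subseteq\mathcal{ISL}$. (2) $\mathcal{BISL}\subsetneq V(\mathbf{A}_5)\subsetneq Bip(\mathcal{BA})$.
   Context: All algebras have type $\langle 2,2,1\rangle$ ($\land,\lor,\lnot$). $\mathcal{BA}$ is the variety of Boolean algebras (generated by the 2-element Boolean algebra $\mathbf{B}_2$). An involutive semilattice is a semilattice $\langle I,\lor\rangle$ with $\lnot\lnot x\approx x$, $\lnot(x\lor y)\approx\lnot x\lor\lnot y$, viewed as type $\langle 2,2,1\rangle$ with $x\land y:=x\lor y$; $\mathcal{ISL}$ is their variety, and $\mathcal{BISL}$ the subvariety satisfying $x\lor\lnot x\approx(x\lor\lnot x)\lor y$ (it is generated by $\mathbf{IS}_3=\{\mathbf{i},\lnot\mathbf{i},\mathbf{j}\}$, $\lnot\mathbf{j}=\mathbf{j}$ top, $\mathbf{i}\lor\lnot\mathbf{i}=\mathbf{j}$). $\mathbf{A}_5$ is the algebra with universe $\{a,b,a',b',u\}$ where: $\{a,b\}$ is a 2-element lattice with $b<a$; $\{a',b'\}$ is a 2-element lattice with $a'<b'$; $\lnot$ swaps $a\leftrightarrow a'$, $b\leftrightarrow b'$ and fixes $u$; and $x\land y=x\lor y=u$ whenever $x,y$ do not both lie in $\{a,b\}$ or both in $\{a',b'\}$ (in particular whenever one of them is $u$). (Equivalently, $\mathbf{A}_5$ is the De Morgan–Płonka sum over $\mathbf{IS}_3$ with 2-element lattice fibres over $\mathbf{i},\lnot\mathbf{i}$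 and a trivial fibre over $\mathbf{j}$.) For a term $\varphi$, $Var^{\pm}(\varphi)$ denote the sets of variables occurring in the scope of an even/odd number of $\lnot$'s; an identity $\varphi\approx\psi$ is bipolarly balanced if either $Var^+(\varphi)\cap Var^-(\varphi)\ne\emptyset\ne Var^+(\psi)\cap Var^-(\psi)$, or $Var^\pm(\varphi)=Var^\pm(\psi)$. $Bip(\mathcal{V})$ is the variety satisfying all and only the bipolarly balanced identities valid in $\mathcal{V}$. $V(\mathbf{A})$ is the variety generated by $\mathbf{A}$. -}

module Defs where

open import Level using (Level; _⊔_) renaming (suc to lsuc; zero to lzero)
open import Data.Nat using (ℕ)
open import Data.Bool using (Bool; true; false; not; _∧_; _∨_)
open import Data.Product using (Σ; ∃; _×_; _,_)
open import Data.Sum using (_⊎_)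
open import Relation.Binary.PropositionalEquality using (_≡_)

infixl 7 _∧ₜ_
infixl 6 _∨ₜ_

data Term : Set where
  var  : ℕ → Term
  _∧ₜ_ : Term → Term → Term
  _∨ₜ_ : Term → Term → Term
  ¬ₜ_  : Term → Term

Identity : Set
Identity = Term × Term

record Algebra : Set₁ where
  field
    Carrier : Set
    meet    : Carrier → Carrier → Carrier
    join    : Carrier → Carrier → Carrier
    neg     : Carrier → Carrier

open Algebra public

eval : (A : Algebra) → (ℕ → Carrier A) → Term → Carrier A
eval A ρ (var x)  = ρ x
eval A ρ (s ∧ₜ t) = meet A (eval A ρ s) (eval A ρ t)
eval A ρ (s ∨ₜ t) = join A (eval A ρ s) (eval A ρ t)
eval A ρ (¬ₜ t)   = neg A (eval A ρ t)

_⊨_ : Algebra → Identity → Set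
A ⊨ (s , t) = ∀ (ρ : ℕ → Carrier A) → eval A ρ s ≡ eval A ρ t

-- Varieties are represented by their equational theories.
-- Th(V(A)) = identities valid in A.

Th : Algebra → Identity → Set
Th A e = A ⊨ e

-- Inclusion of varieties:  V ⊆ W  iff  Th(W) ⊆ Th(V).
_⊆ᵥ_ : {a b : Level} → (Identity → Set a) → (Identity → Set b) → Set (a ⊔ b)
ThV ⊆ᵥ ThW = ∀ e → ThW e → ThV e

_⊊ᵥ_ : {a b : Level} → (Identity → Set a) → (Identity → Set b) → Set (a ⊔ b)
ThV ⊊ᵥ ThW = (ThV ⊆ᵥ ThW) × (ThW ⊆ᵥ ThV → Data.Empty.⊥)
  where import Data.Empty

B₂ : Algebra
B₂ = record { Carrier = Bool ; meet = _∧_ ; join = _∨_ ; neg = not }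

ThBA : Identity → Set
ThBA = Th B₂

-- Involutive semilattices, as algebras of type ⟨2,2,1⟩ with x ∧ y := x ∨ y

record IsInvSemilattice (A : Algebra) : Set where
  field
    ∨-assoc : ∀ (x y z : Carrier A) → join A (join A x y) z ≡ join A x (join A y z)
    ∨-comm  : ∀ (x y : Carrier A) → join A x y ≡ join A y x
    ∨-idem  : ∀ (x : Carrier A) → join A x x ≡ x
    ¬¬      : ∀ (x : Carrier A) → neg A (neg A x) ≡ x
    ¬-∨     : ∀ (x y : Carrier A) → neg A (join A x y) ≡ join A (neg A x) (neg A y)
    ∧=∨     : ∀ (x y : Carrier A) → meet A x y ≡ join A x y

ThISL : Identity → Set₁
ThISL e = ∀ (A : Algebra) → IsInvSemilattice A → A ⊨ e

data IS3 : Set where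
  i ¬i j : IS3

joinIS3 : IS3 → IS3 → IS3
joinIS3 i  i  = i
joinIS3 ¬i ¬i = ¬i
joinIS3 _  _  = j

negIS3 : IS3 → IS3
negIS3 i  = ¬i
negIS3 ¬i = i
negIS3 j  = j

𝐈𝐒₃ : Algebra
𝐈𝐒₃ = record { Carrier = IS3 ; meet = joinIS3 ; join = joinIS3 ; neg = negIS3 }

ThBISL : Identity → Set
ThBISL = Th 𝐈𝐒₃

data A5 : Set where
  a b a' b' u : A5

meetA5 : A5 → A5 → A5
meetA5 a  a  = a
meetA5 a  b  = b
meetA5 b  a  = b
meetA5 b  b  = b
meetA5 a' a' = a'
meetA5 a' b' = a'
meetA5 b' a' = a'
meetA5 b' b' = b'
meetA5 _  _  = u

joinA5 : A5 → A5 → A5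
joinA5 a  a  = a
joinA5 a  b  = a
joinA5 b  a  = a
joinA5 b  b  = b
joinA5 a' a' = a'
joinA5 a' b' = b'
joinA5 b' a' = b'
joinA5 b' b' = b'
joinA5 _  _  = u

negA5 : A5 → A5
negA5 a  = a'
negA5 b  = b'
negA5 a' = a
negA5 b' = b
negA5 u  = u

𝐀₅ : Algebra
𝐀₅ = record { Carrier = A5 ; meet = meetA5 ; join = joinA5 ; neg = negA5 }

-- Polarity of variable occurrences.
-- Occ true φ x : x occurs in φ in the scope of an even number of ¬'s
-- Occ false φ x : ... odd number of ¬'s

Occ : Bool → Term → ℕ → Set
Occ p (var y)  x = (p ≡ true) × (x ≡ y)
Occ p (s ∧ₜ t) x = Occ p s x ⊎ Occ p t x
Occ p (s ∨ₜ t) x = Occ p s x ⊎ Occ p t x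
Occ p (¬ₜ t)   x = Occ (not p) t x

Var⁺ : Term → ℕ → Set
Var⁺ = Occ true

Var⁻ : Term → ℕ → Set
Var⁻ = Occ false

Bipolar : Term → Set
Bipolar φ = ∃ λ x → Var⁺ φ x × Var⁻ φ x

SameVars : (Term → ℕ → Set) → Term → Term → Set
SameVars V φ ψ = ∀ x → (V φ x → V ψ x) × (V ψ x → V φ x)

BipolarlyBalanced : Identity → Set
BipolarlyBalanced (φ , ψ) =
  (Bipolar φ × Bipolar ψ) ⊎ (SameVars Var⁺ φ ψ × SameVars Var⁻ φ ψ)

Bip : {ℓ : Level} → (Identity → Set ℓ) → Identity → Set ℓ
Bip ThV e = BipolarlyBalanced e × ThV e

-- 𝐀₅ is the Płonka sum of two-element lattices over 𝐈𝐒₃: an element is determined by its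
-- index in 𝐈𝐒₃ and its Boolean value inside the fibre, and the value of a term in 𝐀₅ is
-- assembled from its values in 𝐈𝐒₃ and in 𝐁₂. So 𝐀₅ satisfies every identity that holds in
-- both 𝐈𝐒₃ and 𝐁₂, and 𝐈𝐒₃ satisfies every bipolarly balanced identity, because a term takes
-- a value c ≠ j in 𝐈𝐒₃ exactly when all of its literals take the value c. Conversely 𝐈𝐒₃ is a
-- retract of 𝐀₅. The identities x ∨ ¬x ≈ x ∧ ¬x and x ∧ y ≈ x ∨ y separate the rest.
module Submission where

open import Defs
open import Data.Bool using (Bool; true; false; not; _∧_; _∨_)
open import Data.Bool.Properties using (not-involutive)
open import Data.Empty using (⊥-elim)
open import Data.Nat using (ℕ)
open import Data.Product using (_×_; _,_; proj₁; proj₂; swap)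
open import Data.Sum using (inj₁; inj₂)
open import Function using (_∘_)
open import Relation.Nullary using (¬_)
open import Relation.Binary.PropositionalEquality
open ≡-Reasoning

eval-cong : ∀ (A : Algebra) {ρ σ : ℕ → Carrier A} →
            (∀ n → ρ n ≡ σ n) → ∀ t → eval A ρ t ≡ eval A σ t
eval-cong A ρ≗σ (var x)  = ρ≗σ x
eval-cong A ρ≗σ (s ∧ₜ t) = cong₂ (meet A) (eval-cong A ρ≗σ s) (eval-cong A ρ≗σ t)
eval-cong A ρ≗σ (s ∨ₜ t) = cong₂ (join A) (eval-cong A ρ≗σ s) (eval-cong A ρ≗σ t)
eval-cong A ρ≗σ (¬ₜ t)   = cong (neg A) (eval-cong A ρ≗σ t)

⊨-retract : ∀ {A B : Algebra} (f : Carrier A → Carrier B) (s : Carrier B → Carrier A) →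
            (∀ y → f (s y) ≡ y) →
            (∀ ρ t → f (eval A ρ t) ≡ eval B (f ∘ ρ) t) →
            ∀ {e} → A ⊨ e → B ⊨ e
⊨-retract {A} {B} f s f∘s≗id f-eval {φ , ψ} A⊨e σ = begin
  eval B σ φ           ≡⟨ eval-cong B (sym ∘ f∘s≗id ∘ σ) φ ⟩
  eval B (f ∘ s ∘ σ) φ ≡⟨ sym (f-eval (s ∘ σ) φ) ⟩
  f (eval A (s ∘ σ) φ) ≡⟨ cong f (A⊨e (s ∘ σ)) ⟩
  f (eval A (s ∘ σ) ψ) ≡⟨ f-eval (s ∘ σ) ψ ⟩
  eval B (f ∘ s ∘ σ) ψ ≡⟨ eval-cong B (f∘s≗id ∘ σ) ψ ⟩
  eval B σ ψ           ∎

negIS3-involutive : ∀ v → negIS3 (negIS3 v) ≡ v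
negIS3-involutive i  = refl
negIS3-involutive ¬i = refl
negIS3-involutive j  = refl

negIS3-injective : ∀ {v w} → negIS3 v ≡ negIS3 w → v ≡ w
negIS3-injective {v} {w} eq = begin
  v                 ≡⟨ sym (negIS3-involutive v) ⟩
  negIS3 (negIS3 v) ≡⟨ cong negIS3 eq ⟩
  negIS3 (negIS3 w) ≡⟨ negIS3-involutive w ⟩
  w                 ∎

negIS3-fixed⇒j : ∀ {c} → negIS3 c ≡ c → c ≡ j
negIS3-fixed⇒j {j} refl = refl

negIS3-proper : ∀ {c} → c ≢ j → negIS3 c ≢ j
negIS3-proper c≢j eq = c≢j (negIS3-injective eq)

joinIS3-idem : ∀ c → joinIS3 c c ≡ c
joinIS3-idem i  = refl
joinIS3-idem ¬i = refl
joinIS3-idem j  = refl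

joinIS3≡proper⇒ : ∀ x y {c} → c ≢ j → joinIS3 x y ≡ c → x ≡ c × y ≡ c
joinIS3≡proper⇒ i  i  _   refl = refl , refl
joinIS3≡proper⇒ ¬i ¬i _   refl = refl , refl
joinIS3≡proper⇒ i  ¬i c≢j refl = ⊥-elim (c≢j refl)
joinIS3≡proper⇒ i  j  c≢j refl = ⊥-elim (c≢j refl)
joinIS3≡proper⇒ ¬i i  c≢j refl = ⊥-elim (c≢j refl)
joinIS3≡proper⇒ ¬i j  c≢j refl = ⊥-elim (c≢j refl)
joinIS3≡proper⇒ j  _  c≢j refl = ⊥-elim (c≢j refl)

≡-by-proper-values : ∀ {x y} → (∀ c → c ≢ j → x ≡ c → y ≡ c) →
                     (∀ c → c ≢ j → y ≡ c → x ≡ c) → x ≡ y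
≡-by-proper-values {i}      x⇒y y⇒x = sym (x⇒y i (λ ()) refl)
≡-by-proper-values {¬i}     x⇒y y⇒x = sym (x⇒y ¬i (λ ()) refl)
≡-by-proper-values {j} {i}  x⇒y y⇒x = y⇒x i (λ ()) refl
≡-by-proper-values {j} {¬i} x⇒y y⇒x = y⇒x ¬i (λ ()) refl
≡-by-proper-values {j} {j}  x⇒y y⇒x = refl

withPolarity : Bool → IS3 → IS3
withPolarity true  v = v
withPolarity false v = negIS3 v

withPolarity-not : ∀ p v → withPolarity (not p) v ≡ negIS3 (withPolarity p v)
withPolarity-not true  v = refl
withPolarity-not false v = sym (negIS3-involutive v)

module _ (ρ : ℕ → IS3) where

  Uniform : IS3 → Term → Set
  Uniform c t = ∀ p x → Occ p t x → withPolarity p (ρ x) ≡ c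

  uniform-¬⁻ : ∀ {c} t → Uniform c (¬ₜ t) → Uniform (negIS3 c) t
  uniform-¬⁻ {c} t U p x o = negIS3-injective (begin
    negIS3 (withPolarity p (ρ x)) ≡⟨ sym (withPolarity-not p (ρ x)) ⟩
    withPolarity (not p) (ρ x)    ≡⟨ U (not p) x (subst (λ q → Occ q t x) (sym (not-involutive p)) o) ⟩
    c                             ≡⟨ sym (negIS3-involutive c) ⟩
    negIS3 (negIS3 c)             ∎)

  uniform-¬⁺ : ∀ {c} t → Uniform (negIS3 c) t → Uniform c (¬ₜ t)
  uniform-¬⁺ t U p x o = negIS3-injective (trans (sym (withPolarity-not p (ρ x))) (U (not p) x o))

  uniform⇒eval≡ : ∀ {c} t → Uniform c t → eval 𝐈𝐒₃ ρ t ≡ c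
  uniform⇒eval≡ (var x)  U = U true x (refl , refl)
  uniform⇒eval≡ {c} (s ∧ₜ t) U = trans
    (cong₂ joinIS3 (uniform⇒eval≡ s (λ p x → U p x ∘ inj₁)) (uniform⇒eval≡ t (λ p x → U p x ∘ inj₂)))
    (joinIS3-idem c)
  uniform⇒eval≡ {c} (s ∨ₜ t) U = trans
    (cong₂ joinIS3 (uniform⇒eval≡ s (λ p x → U p x ∘ inj₁)) (uniform⇒eval≡ t (λ p x → U p x ∘ inj₂)))
    (joinIS3-idem c)
  uniform⇒eval≡ {c} (¬ₜ t) U = begin
    negIS3 (eval 𝐈𝐒₃ ρ t) ≡⟨ cong negIS3 (uniform⇒eval≡ t (uniform-¬⁻ t U)) ⟩
    negIS3 (negIS3 c)     ≡⟨ negIS3-involutive c ⟩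
    c                     ∎

  -- Unlike uniform⇒eval≡ this needs c ≢ j: a join can be j without either argument being j.
  eval≡proper⇒uniform : ∀ {c} t → c ≢ j → eval 𝐈𝐒₃ ρ t ≡ c → Uniform c t
  eval≡proper⇒uniform (var y) c≢j e .true .y (refl , refl) = e
  eval≡proper⇒uniform (s ∧ₜ t) c≢j e p x (inj₁ o) =
    eval≡proper⇒uniform s c≢j (proj₁ (joinIS3≡proper⇒ _ _ c≢j e)) p x o
  eval≡proper⇒uniform (s ∧ₜ t) c≢j e p x (inj₂ o) =
    eval≡proper⇒uniform t c≢j (proj₂ (joinIS3≡proper⇒ _ _ c≢j e)) p x o
  eval≡proper⇒uniform (s ∨ₜ t) c≢j e p x (inj₁ o) =
    eval≡proper⇒uniform s c≢j (proj₁ (joinIS3≡proper⇒ _ _ c≢j e)) p x o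
  eval≡proper⇒uniform (s ∨ₜ t) c≢j e p x (inj₂ o) =
    eval≡proper⇒uniform t c≢j (proj₂ (joinIS3≡proper⇒ _ _ c≢j e)) p x o
  eval≡proper⇒uniform {c} (¬ₜ t) c≢j e = uniform-¬⁺ t
    (eval≡proper⇒uniform t (negIS3-proper c≢j) (negIS3-injective (trans e (sym (negIS3-involutive c)))))

  bipolar⇒eval≢proper : ∀ {c} t → Bipolar t → c ≢ j → eval 𝐈𝐒₃ ρ t ≢ c
  bipolar⇒eval≢proper {c} t (x , x⁺ , x⁻) c≢j e = c≢j (negIS3-fixed⇒j (begin
    negIS3 c     ≡⟨ cong negIS3 (sym (U true x x⁺)) ⟩
    negIS3 (ρ x) ≡⟨ U false x x⁻ ⟩
    c            ∎))
    where
    U : Uniform c t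
    U = eval≡proper⇒uniform t c≢j e

  sameVars⇒eval≡proper : ∀ {c} φ ψ → SameVars Var⁺ φ ψ → SameVars Var⁻ φ ψ →
                          c ≢ j → eval 𝐈𝐒₃ ρ φ ≡ c → eval 𝐈𝐒₃ ρ ψ ≡ c
  sameVars⇒eval≡proper {c} φ ψ S⁺ S⁻ c≢j e = uniform⇒eval≡ ψ transfer
    where
    U : Uniform c φ
    U = eval≡proper⇒uniform φ c≢j e
    transfer : Uniform c ψ
    transfer true  x o = U true  x (proj₂ (S⁺ x) o)
    transfer false x o = U false x (proj₂ (S⁻ x) o)

𝐈𝐒₃⊨balanced : ∀ {e} → BipolarlyBalanced e → 𝐈𝐒₃ ⊨ e
𝐈𝐒₃⊨balanced {φ , ψ} (inj₁ (bφ , bψ)) ρ = ≡-by-proper-values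
  (λ c c≢j e → ⊥-elim (bipolar⇒eval≢proper ρ φ bφ c≢j e))
  (λ c c≢j e → ⊥-elim (bipolar⇒eval≢proper ρ ψ bψ c≢j e))
𝐈𝐒₃⊨balanced {φ , ψ} (inj₂ (S⁺ , S⁻)) ρ = ≡-by-proper-values
  (λ c → sameVars⇒eval≡proper ρ φ ψ S⁺ S⁻)
  (λ c → sameVars⇒eval≡proper ρ ψ φ (swap ∘ S⁺) (swap ∘ S⁻))

index : A5 → IS3
index a  = i
index b  = i
index a' = ¬i
index b' = ¬i
index u  = j

value : A5 → Bool
value a  = true
value b  = false
value a' = false
value b' = true
value u  = false

-- The fibres over i and ¬i are identified with 𝐁₂ so that ¬ maps each onto the other by
-- Boolean complement; the fibre over j is {u}.
decode : IS3 → Bool → A5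
decode i  true  = a
decode i  false = b
decode ¬i true  = b'
decode ¬i false = a'
decode j  _     = u

decode-index-value : ∀ x → decode (index x) (value x) ≡ x
decode-index-value a  = refl
decode-index-value b  = refl
decode-index-value a' = refl
decode-index-value b' = refl
decode-index-value u  = refl

index-decode : ∀ c p → index (decode c p) ≡ c
index-decode i  true  = refl
index-decode i  false = refl
index-decode ¬i true  = refl
index-decode ¬i false = refl
index-decode j  _     = refl

meet-decode : ∀ c p d q → meetA5 (decode c p) (decode d q) ≡ decode (joinIS3 c d) (p ∧ q)
meet-decode i  true  i  true  = refl
meet-decode i  true  i  false = refl
meet-decode i  true  ¬i true  = refl
meet-decode i  true  ¬i false = refl
meet-decode i  true  j  _     = refl
meet-decode i  false i  true  = refl
meet-decode i  false i  false = refl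
meet-decode i  false ¬i true  = refl
meet-decode i  false ¬i false = refl
meet-decode i  false j  _     = refl
meet-decode ¬i true  i  true  = refl
meet-decode ¬i true  i  false = refl
meet-decode ¬i true  ¬i true  = refl
meet-decode ¬i true  ¬i false = refl
meet-decode ¬i true  j  _     = refl
meet-decode ¬i false i  true  = refl
meet-decode ¬i false i  false = refl
meet-decode ¬i false ¬i true  = refl
meet-decode ¬i false ¬i false = refl
meet-decode ¬i false j  _     = refl
meet-decode j  _     _  _     = refl

join-decode : ∀ c p d q → joinA5 (decode c p) (decode d q) ≡ decode (joinIS3 c d) (p ∨ q)
join-decode i  true  i  true  = refl
join-decode i  true  i  false = refl
join-decode i  true  ¬i true  = refl
join-decode i  true  ¬i false = refl
join-decode i  true  j  _     = refl
join-decode i  false i  true  = refl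
join-decode i  false i  false = refl
join-decode i  false ¬i true  = refl
join-decode i  false ¬i false = refl
join-decode i  false j  _     = refl
join-decode ¬i true  i  true  = refl
join-decode ¬i true  i  false = refl
join-decode ¬i true  ¬i true  = refl
join-decode ¬i true  ¬i false = refl
join-decode ¬i true  j  _     = refl
join-decode ¬i false i  true  = refl
join-decode ¬i false i  false = refl
join-decode ¬i false ¬i true  = refl
join-decode ¬i false ¬i false = refl
join-decode ¬i false j  _     = refl
join-decode j  _     _  _     = refl

neg-decode : ∀ c p → negA5 (decode c p) ≡ decode (negIS3 c) (not p)
neg-decode i  true  = refl
neg-decode i  false = refl
neg-decode ¬i true  = refl
neg-decode ¬i false = refl
neg-decode j  _     = refl

eval-decode : ∀ ρ t → eval 𝐀₅ ρ t ≡ decode (eval 𝐈𝐒₃ (index ∘ ρ) t) (eval B₂ (value ∘ ρ) t)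
eval-decode ρ (var x)  = sym (decode-index-value (ρ x))
eval-decode ρ (s ∧ₜ t) = trans (cong₂ meetA5 (eval-decode ρ s) (eval-decode ρ t)) (meet-decode _ _ _ _)
eval-decode ρ (s ∨ₜ t) = trans (cong₂ joinA5 (eval-decode ρ s) (eval-decode ρ t)) (join-decode _ _ _ _)
eval-decode ρ (¬ₜ t)   = trans (cong negA5 (eval-decode ρ t)) (neg-decode _ _)

index-eval : ∀ ρ t → index (eval 𝐀₅ ρ t) ≡ eval 𝐈𝐒₃ (index ∘ ρ) t
index-eval ρ t = trans (cong index (eval-decode ρ t)) (index-decode _ _)

𝐀₅⊨⇒𝐈𝐒₃⊨ : ∀ e → Th 𝐀₅ e → ThBISL e
𝐀₅⊨⇒𝐈𝐒₃⊨ e = ⊨-retract index (λ c → decode c true) (λ c → index-decode c true) index-eval {e}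

𝐁₂⊨balanced⇒𝐀₅⊨ : ∀ e → Bip ThBA e → Th 𝐀₅ e
𝐁₂⊨balanced⇒𝐀₅⊨ (φ , ψ) (balanced , B₂⊨e) ρ = begin
  eval 𝐀₅ ρ φ                            ≡⟨ eval-decode ρ φ ⟩
  decode (eval 𝐈𝐒₃ σ φ) (eval B₂ β φ) ≡⟨ cong₂ decode (𝐈𝐒₃⊨balanced {φ , ψ} balanced σ) (B₂⊨e β) ⟩
  decode (eval 𝐈𝐒₃ σ ψ) (eval B₂ β ψ) ≡⟨ sym (eval-decode ρ ψ) ⟩
  eval 𝐀₅ ρ ψ                            ∎
  where
  σ : ℕ → IS3
  σ = index ∘ ρ
  β : ℕ → Bool
  β = value ∘ ρ

x∨¬x≈x∧¬x : Identity
x∨¬x≈x∧¬x = (var 0 ∨ₜ ¬ₜ var 0) , (var 0 ∧ₜ ¬ₜ var 0)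

𝐀₅⊨x∨¬x≈x∧¬x : Th 𝐀₅ x∨¬x≈x∧¬x
𝐀₅⊨x∨¬x≈x∧¬x ρ with ρ 0
... | a  = refl
... | b  = refl
... | a' = refl
... | b' = refl
... | u  = refl

B₂⊭x∨¬x≈x∧¬x : ¬ ThBA x∨¬x≈x∧¬x
B₂⊭x∨¬x≈x∧¬x B₂⊨ with B₂⊨ (λ _ → true)
... | ()

x∧y≈x∨y : Identity
x∧y≈x∨y = (var 0 ∧ₜ var 1) , (var 0 ∨ₜ var 1)

ISL⊨x∧y≈x∨y : ThISL x∧y≈x∨y
ISL⊨x∧y≈x∨y A isISL ρ = IsInvSemilattice.∧=∨ isISL _ _

𝐈𝐒₃⊨x∧y≈x∨y : ThBISL x∧y≈x∨y
𝐈𝐒₃⊨x∧y≈x∨y ρ = refl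

𝐀₅⊭x∧y≈x∨y : ¬ Th 𝐀₅ x∧y≈x∨y
𝐀₅⊭x∧y≈x∨y 𝐀₅⊨ with 𝐀₅⊨ (λ { 0 → a ; _ → b })
... | ()

fact4p9 : ((¬ (ThBA ⊆ᵥ Th 𝐀₅)) × (¬ (Th 𝐀₅ ⊆ᵥ ThISL)))
        × ((ThBISL ⊊ᵥ Th 𝐀₅) × (Th 𝐀₅ ⊊ᵥ Bip ThBA))
fact4p9 =
  ( (λ BA⊆ → B₂⊭x∨¬x≈x∧¬x (BA⊆ x∨¬x≈x∧¬x 𝐀₅⊨x∨¬x≈x∧¬x))
  , (λ A₅⊆ → 𝐀₅⊭x∧y≈x∨y (A₅⊆ x∧y≈x∨y ISL⊨x∧y≈x∨y)) )
  , ( (𝐀₅⊨⇒𝐈𝐒₃⊨ , λ A₅⊆ → 𝐀₅⊭x∧y≈x∨y (A₅⊆ x∧y≈x∨y 𝐈𝐒₃⊨x∧y≈x∨y))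
    , (𝐁₂⊨balanced⇒𝐀₅⊨ , λ BipBA⊆ → B₂⊭x∨¬x≈x∧¬x (proj₂ (BipBA⊆ x∨¬x≈x∧¬x 𝐀₅⊨x∨¬x≈x∧¬x))) )
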